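{- Let $j,k$ be integers with $k+250<j<3k/2$, $j\ge 212299$ and $k\ge 141534$. Let $G$ be a complete graph on $4j+1$ vertices whose edges are colored red and blue such that the red subgraph contains no cycle $C_{2k+1}$ and the blue subgraph contains no wheel $W_{2j}$. Let $v$ be a vertex of $G$ of maximum blue degree and let $H$ be the subgraph induced on the blue neighborhood $N^B(v)$. Let $a,b$ be vertices of $H$ joined by a red edge, each having fewer than $j$ blue neighbors in $H$. Let $C$ be a red cycle of length $2j-502$ in $H-a-b$, with vertices labeled by $\mathbb{Z}/(2j-502)\mathbb{Z}$ so that $i$ and $i+1$ are consecutive on $C$. Suppose there is a vertex $c$ of $H$, not on $C$ and distinct from $a,b$, such that the edges $ac$ and $bc$ are red. For each label $i$ set $A_i=1$ if the edge $ai$ is red and $A_i=0$ if blue, and $B_i=1$ if $bi$ is red and $B_i=0$ if blue. Then $|\{x: A_x=B_{x+2k-3}\}|\le 500$ and $|\{x: B_x=A_{x+2k-3}\}|\le 500$.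
   Context: $C_m$ is the cycle of length $m$; the wheel $W_{n}$ consists of a cycle $C_n$ together with a hub vertex adjacent to all cycle vertices. Indices of labels are taken modulo $2j-502$. -}

module Defs where

open import Data.Nat using (ℕ; zero; suc; _+_; _≤_; _%_)
open import Data.Nat.DivMod using (m%n<n)
open import Data.Bool using (Bool; true; false; not; _∧_)
import Data.Bool as B
open import Data.Fin using (Fin; toℕ; fromℕ<)
import Data.Fin as F
open import Data.Product using (Σ; _×_)
open import Relation.Binary.PropositionalEquality using (_≡_; _≢_)
open import Relation.Nullary.Decidable using (⌊_⌋)
open import Function.Definitions using (Injective)

countFin : (n : ℕ) → (Fin n → Bool) → ℕ
countFin zero    p = 0
countFin (suc n) p = (if p F.zero then 1 else 0) + countFin n (λ x → p (F.suc x))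
  where open Data.Bool using (if_then_else_)

addMod : {L : ℕ} → Fin L → ℕ → Fin L
addMod {suc m} x t = fromℕ< (m%n<n (toℕ x + t) (suc m))

_==F_ : {n : ℕ} → Fin n → Fin n → Bool
x ==F y = ⌊ x F.≟ y ⌋

_==B_ : Bool → Bool → Bool
x ==B y = ⌊ x B.≟ y ⌋

-- A 2-edge-colouring of the complete graph on Fin N:
-- col u v ≡ true means the edge uv is red, false means blue
-- (only used for u ≢ v; symmetry is a hypothesis of the theorem).
Colouring : ℕ → Set
Colouring N = Fin N → Fin N → Bool

SymColouring : {N : ℕ} → Colouring N → Set
SymColouring {N} col = ∀ (u v : Fin N) → col u v ≡ col v u

IsCycle : {N m : ℕ} → (Fin N → Fin N → Bool) → (Fin m → Fin N) → Set
IsCycle adj c = Injective _≡_ _≡_ c × (∀ i → adj (c i) (c (addMod i 1)) ≡ true)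

HasCycle : {N : ℕ} → (Fin N → Fin N → Bool) → ℕ → Set
HasCycle {N} adj m = Σ (Fin m → Fin N) (λ c → IsCycle adj c)

-- a wheel W_m: a cycle C_m (rim) plus a hub adjacent to all rim vertices
HasWheel : {N : ℕ} → (Fin N → Fin N → Bool) → ℕ → Set
HasWheel {N} adj m =
  Σ (Fin N) (λ h → Σ (Fin m → Fin N) (λ c →
    IsCycle adj c × (∀ i → c i ≢ h) × (∀ i → adj h (c i) ≡ true)))

redAdj : {N : ℕ} → Colouring N → Fin N → Fin N → Bool
redAdj col u v = col u v

blueAdj : {N : ℕ} → Colouring N → Fin N → Fin N → Bool
blueAdj col u v = not (col u v)

blueDeg : {N : ℕ} → Colouring N → Fin N → ℕ
blueDeg {N} col w = countFin N (λ u → not (u ==F w) ∧ not (col w u))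

MaxBlueDeg : {N : ℕ} → Colouring N → Fin N → Set
MaxBlueDeg {N} col v = ∀ (w : Fin N) → blueDeg col w ≤ blueDeg col v

inHb : {N : ℕ} → Colouring N → Fin N → Fin N → Bool
inHb col v u = not (u ==F v) ∧ not (col v u)

InH : {N : ℕ} → Colouring N → Fin N → Fin N → Set
InH col v u = inHb col v u ≡ true

blueDegH : {N : ℕ} → Colouring N → Fin N → Fin N → ℕ
blueDegH {N} col v a = countFin N (λ u → inHb col v u ∧ not (u ==F a) ∧ not (col a u))

module Submission where

-- Put s = 2k − 3. If A_x = B_{x+s} = 1, the red arc C(x), …, C(x+s) of C closes
-- through b, c, a into a red cycle of length s + 4 = 2k + 1, which is excluded.
-- So every label x contributes at least [A_x = B_{x+s}] + 1 blue edges among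
-- a C(x) and b C(x+s). Summing over the L = 2j − 502 labels, the number of agreements
-- plus L is at most the sum of the blue degrees of a and b in H, which is at most 2j − 2.

open import Data.Nat
open import Data.Nat.Properties
open import Data.Nat.DivMod
open import Data.Fin using (Fin; toℕ)
import Data.Fin as F
import Data.Fin.Properties as FP
open import Data.Bool using (Bool; true; false; not; _∧_; if_then_else_)
open import Data.Bool.Properties using (∧-identityʳ)
open import Data.Product using (_×_; _,_; proj₁; proj₂; ∃-syntax)
open import Data.Sum using (_⊎_; inj₁; inj₂)
open import Data.Empty using (⊥-elim)
open import Function.Definitions using (Injective)
open import Relation.Binary.PropositionalEquality
open import Relation.Nullary using (¬_; yes; no)
open import Relation.Nullary.Decidable using (dec-true; dec-false; isYes≗does; ⌊⌋-map′)
open import Data.Nat.Tactic.RingSolver using (solve-∀)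
open import Function using (_∘_)

open import Defs

indicator : Bool → ℕ
indicator b = if b then 1 else 0

==F-refl : ∀ {n} (x : Fin n) → x ==F x ≡ true
==F-refl x = trans (isYes≗does (x F.≟ x)) (dec-true (x F.≟ x) refl)

==F-≢ : ∀ {n} {x y : Fin n} → x ≢ y → x ==F y ≡ false
==F-≢ {x = x} {y} x≢y = trans (isYes≗does (x F.≟ y)) (dec-false (x F.≟ y) x≢y)

==F-suc : ∀ {n} (x y : Fin n) → F.suc x ==F F.suc y ≡ x ==F y
==F-suc x y = ⌊⌋-map′ _ _ (x F.≟ y)

countFin-cong : ∀ n {p q : Fin n → Bool} → (∀ x → p x ≡ q x) → countFin n p ≡ countFin n q
countFin-cong zero    p≡q = refl
countFin-cong (suc n) p≡q = cong₂ _+_ (cong indicator (p≡q F.zero)) (countFin-cong n (p≡q ∘ F.suc))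


countFin-remove : ∀ n (q : Fin n → Bool) u → q u ≡ true →
  suc (countFin n (λ w → q w ∧ not (w ==F u))) ≡ countFin n q
countFin-remove (suc n) q F.zero qu rewrite qu | ==F-refl (F.zero {n}) =
  cong suc (countFin-cong n (λ x → ∧-identityʳ (q (F.suc x))))
countFin-remove (suc n) q (F.suc u) qu = begin
  suc (indicator (q F.zero ∧ true) + countFin n (λ x → q (F.suc x) ∧ not (F.suc x ==F F.suc u)))
    ≡⟨ cong suc (cong₂ _+_ (cong indicator (∧-identityʳ (q F.zero)))
                           (countFin-cong n (λ x → cong (λ e → q (F.suc x) ∧ not e) (==F-suc x u)))) ⟩
  suc (indicator (q F.zero) + countFin n (λ x → q (F.suc x) ∧ not (x ==F u)))
    ≡⟨ +-suc (indicator (q F.zero)) _ ⟨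
  indicator (q F.zero) + suc (countFin n (λ x → q (F.suc x) ∧ not (x ==F u)))
    ≡⟨ cong (indicator (q F.zero) +_) (countFin-remove n (λ x → q (F.suc x)) u qu) ⟩
  indicator (q F.zero) + countFin n (λ x → q (F.suc x)) ∎
  where open ≡-Reasoning

countFin-≤-injection : ∀ m n (g : Fin m → Fin n) → Injective _≡_ _≡_ g →
  (p : Fin m → Bool) (q : Fin n → Bool) → (∀ x → p x ≡ true → q (g x) ≡ true) →
  countFin m p ≤ countFin n q
countFin-≤-injection zero    n g g-inj p q p⇒q = z≤n
countFin-≤-injection (suc m) n g g-inj p q p⇒q with p F.zero in p0
... | false = countFin-≤-injection m n (g ∘ F.suc) (FP.suc-injective ∘ g-inj) (p ∘ F.suc) q (p⇒q ∘ F.suc)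
... | true = begin
  suc (countFin m (p ∘ F.suc))                         ≤⟨ s≤s (countFin-≤-injection m n (g ∘ F.suc)
                                                             (FP.suc-injective ∘ g-inj) (p ∘ F.suc) q′ p⇒q′) ⟩
  suc (countFin n q′)                                  ≡⟨ countFin-remove n q (g F.zero) (p⇒q F.zero p0) ⟩
  countFin n q                                         ∎
  where
  open ≤-Reasoning
  q′ : Fin n → Bool
  q′ u = q u ∧ not (u ==F g F.zero)
  p⇒q′ : ∀ x → p (F.suc x) ≡ true → q′ (g (F.suc x)) ≡ true
  p⇒q′ x px rewrite p⇒q (F.suc x) px | ==F-≢ {x = g (F.suc x)} {g F.zero} (λ e → FP.0≢1+n (sym (g-inj e))) = refl

countFin-+-pointwise : ∀ n (r p q : Fin n → Bool) →
  (∀ x → indicator (r x) + 1 ≤ indicator (p x) + indicator (q x)) →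
  countFin n r + n ≤ countFin n p + countFin n q
countFin-+-pointwise zero    r p q r≤p+q = z≤n
countFin-+-pointwise (suc n) r p q r≤p+q = begin
  (r₀ + R) + suc n   ≡⟨ shift-suc r₀ R n ⟩
  (r₀ + 1) + (R + n) ≤⟨ +-mono-≤ (r≤p+q F.zero) (countFin-+-pointwise n (r ∘ F.suc) (p ∘ F.suc) (q ∘ F.suc) (r≤p+q ∘ F.suc)) ⟩
  (p₀ + q₀) + (P + Q) ≡⟨ interchange p₀ q₀ P Q ⟩
  (p₀ + P) + (q₀ + Q) ∎
  where
  open ≤-Reasoning
  r₀ = indicator (r F.zero)
  p₀ = indicator (p F.zero)
  q₀ = indicator (q F.zero)
  R = countFin n (r ∘ F.suc)
  P = countFin n (p ∘ F.suc)
  Q = countFin n (q ∘ F.suc)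
  shift-suc : ∀ a b c → (a + b) + suc c ≡ (a + 1) + (b + c)
  shift-suc = solve-∀
  interchange : ∀ a b c d → (a + b) + (c + d) ≡ (a + c) + (b + d)
  interchange = solve-∀

[m+n%d]%d≡[m+n]%d : ∀ m n d .{{_ : NonZero d}} → (m + n % d) % d ≡ (m + n) % d
[m+n%d]%d≡[m+n]%d m n d = begin
  (m + n % d) % d               ≡⟨ [m+kn]%n≡m%n (m + n % d) (n / d) d ⟨
  (m + n % d + n / d * d) % d   ≡⟨ cong (_% d) (+-assoc m (n % d) (n / d * d)) ⟩
  (m + (n % d + n / d * d)) % d ≡⟨ cong (λ e → (m + e) % d) (m≡m%n+[m/n]*n n d) ⟨
  (m + n) % d                   ∎
  where open ≡-Reasoning

toℕ-addMod : ∀ {m} (x : Fin (suc m)) t → toℕ (addMod x t) ≡ (toℕ x + t) % suc m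
toℕ-addMod {m} x t = FP.toℕ-fromℕ< (m%n<n (toℕ x + t) (suc m))

addMod-cong : ∀ {m} (x : Fin (suc m)) {t u} → t % suc m ≡ u % suc m → addMod x t ≡ addMod x u
addMod-cong {m} x {t} {u} t≡u = FP.toℕ-injective (begin
  toℕ (addMod x t)          ≡⟨ toℕ-addMod x t ⟩
  (toℕ x + t) % suc m       ≡⟨ [m+n%d]%d≡[m+n]%d (toℕ x) t (suc m) ⟨
  (toℕ x + t % suc m) % suc m ≡⟨ cong (λ e → (toℕ x + e) % suc m) t≡u ⟩
  (toℕ x + u % suc m) % suc m ≡⟨ [m+n%d]%d≡[m+n]%d (toℕ x) u (suc m) ⟩
  (toℕ x + u) % suc m       ≡⟨ toℕ-addMod x u ⟨
  toℕ (addMod x u)          ∎)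
  where open ≡-Reasoning

addMod-zero : ∀ {L} (x : Fin L) → addMod x 0 ≡ x
addMod-zero {suc m} x = FP.toℕ-injective (begin
  toℕ (addMod x 0)    ≡⟨ toℕ-addMod x 0 ⟩
  (toℕ x + 0) % suc m ≡⟨ cong (_% suc m) (+-identityʳ (toℕ x)) ⟩
  toℕ x % suc m       ≡⟨ m<n⇒m%n≡m (FP.toℕ<n x) ⟩
  toℕ x               ∎)
  where open ≡-Reasoning

addMod-+ : ∀ {L} (x : Fin L) t u → addMod (addMod x t) u ≡ addMod x (t + u)
addMod-+ {suc m} x t u = FP.toℕ-injective (begin
  toℕ (addMod (addMod x t) u)   ≡⟨ toℕ-addMod (addMod x t) u ⟩
  (toℕ (addMod x t) + u) % suc m ≡⟨ cong (λ e → (e + u) % suc m) (toℕ-addMod x t) ⟩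
  ((toℕ x + t) % suc m + u) % suc m ≡⟨ cong (_% suc m) (+-comm ((toℕ x + t) % suc m) u) ⟩
  (u + (toℕ x + t) % suc m) % suc m ≡⟨ [m+n%d]%d≡[m+n]%d u (toℕ x + t) (suc m) ⟩
  (u + (toℕ x + t)) % suc m      ≡⟨ cong (_% suc m) (trans (+-comm u (toℕ x + t)) (+-assoc (toℕ x) t u)) ⟩
  (toℕ x + (t + u)) % suc m      ≡⟨ toℕ-addMod x (t + u) ⟨
  toℕ (addMod x (t + u))         ∎)
  where open ≡-Reasoning

addMod-suc : ∀ {L} (x : Fin L) t → addMod (addMod x t) 1 ≡ addMod x (suc t)
addMod-suc x t = trans (addMod-+ x t 1) (cong (addMod x) (+-comm t 1))

addMod-inverse : ∀ {m} (x : Fin (suc m)) t → addMod (addMod x t) (suc m ∸ t % suc m) ≡ x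
addMod-inverse {m} x t = begin
  addMod (addMod x t) (suc m ∸ t % suc m) ≡⟨ addMod-+ x t _ ⟩
  addMod x (t + (suc m ∸ t % suc m))      ≡⟨ addMod-cong x multiple ⟩
  addMod x 0                              ≡⟨ addMod-zero x ⟩
  x                                       ∎
  where
  open ≡-Reasoning
  multiple : (t + (suc m ∸ t % suc m)) % suc m ≡ 0
  multiple = begin
    (t + (suc m ∸ t % suc m)) % suc m       ≡⟨ cong (_% suc m) (+-comm t _) ⟩
    ((suc m ∸ t % suc m) + t) % suc m       ≡⟨ [m+n%d]%d≡[m+n]%d (suc m ∸ t % suc m) t (suc m) ⟨
    ((suc m ∸ t % suc m) + t % suc m) % suc m ≡⟨ cong (_% suc m) (m∸n+n≡m (m%n≤n t (suc m))) ⟩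
    suc m % suc m                           ≡⟨ n%n≡0 (suc m) ⟩
    0                                       ∎

addMod-injectiveˡ : ∀ {L} t → Injective _≡_ _≡_ (λ (x : Fin L) → addMod x t)
addMod-injectiveˡ {suc m} t {x} {y} x+t≡y+t = begin
  x                                       ≡⟨ addMod-inverse x t ⟨
  addMod (addMod x t) (suc m ∸ t % suc m) ≡⟨ cong (λ z → addMod z (suc m ∸ t % suc m)) x+t≡y+t ⟩
  addMod (addMod y t) (suc m ∸ t % suc m) ≡⟨ addMod-inverse y t ⟩
  y                                       ∎
  where open ≡-Reasoning

addMod-comm : ∀ {L} (x : Fin L) {t} (t<L : t < L) → addMod x t ≡ addMod (F.fromℕ< t<L) (toℕ x)
addMod-comm {suc m} x {t} t<L = FP.toℕ-injective (begin
  toℕ (addMod x t)                   ≡⟨ toℕ-addMod x t ⟩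
  (toℕ x + t) % suc m                ≡⟨ cong (_% suc m) (+-comm (toℕ x) t) ⟩
  (t + toℕ x) % suc m                ≡⟨ cong (λ e → (e + toℕ x) % suc m) (FP.toℕ-fromℕ< t<L) ⟨
  (toℕ (F.fromℕ< t<L) + toℕ x) % suc m ≡⟨ toℕ-addMod (F.fromℕ< t<L) (toℕ x) ⟨
  toℕ (addMod (F.fromℕ< t<L) (toℕ x)) ∎)
  where open ≡-Reasoning

addMod-injectiveʳ : ∀ {L} (x : Fin L) {t u} → t < L → u < L → addMod x t ≡ addMod x u → t ≡ u
addMod-injectiveʳ x {t} {u} t<L u<L x+t≡x+u = begin
  t                    ≡⟨ FP.toℕ-fromℕ< t<L ⟨
  toℕ (F.fromℕ< t<L)   ≡⟨ cong toℕ (addMod-injectiveˡ (toℕ x)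
                            (trans (sym (addMod-comm x t<L)) (trans x+t≡x+u (addMod-comm x u<L)))) ⟩
  toℕ (F.fromℕ< u<L)   ≡⟨ FP.toℕ-fromℕ< u<L ⟩
  u                    ∎
  where open ≡-Reasoning

record IsPath {N : ℕ} (adj : Fin N → Fin N → Bool) (n : ℕ) (p : ℕ → Fin N) : Set where
  field
    injective : ∀ {t u} → t ≤ n → u ≤ n → p t ≡ p u → t ≡ u
    adjacent  : ∀ {t} → t < n → adj (p t) (p (suc t)) ≡ true

IsPath⇒HasCycle : ∀ {N n} {adj : Fin N → Fin N → Bool} {p : ℕ → Fin N} →
  IsPath adj n p → adj (p n) (p 0) ≡ true → HasCycle adj (suc n)
IsPath⇒HasCycle {n = n} {adj} {p} path closing =
  p ∘ toℕ , (λ {i} {j} e → FP.toℕ-injective (injective (bound i) (bound j) e)) , adjacent′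
  where
  open IsPath path
  bound : (i : Fin (suc n)) → toℕ i ≤ n
  bound i = s≤s⁻¹ (FP.toℕ<n i)
  adjacent′ : ∀ i → adj (p (toℕ i)) (p (toℕ (addMod i 1))) ≡ true
  adjacent′ i with m≤n⇒m<n∨m≡n (bound i)
  ... | inj₁ i<n = subst (λ t → adj (p (toℕ i)) (p t) ≡ true) (sym next) (adjacent i<n)
    where
    next : toℕ (addMod i 1) ≡ suc (toℕ i)
    next = trans (toℕ-addMod i 1) (trans (cong (_% suc n) (+-comm (toℕ i) 1)) (m<n⇒m%n≡m (s≤s i<n)))
  ... | inj₂ i≡n = subst₂ (λ t t′ → adj (p t) (p t′) ≡ true) (sym i≡n) (sym wrap) closing
    where
    wrap : toℕ (addMod i 1) ≡ 0
    wrap = trans (toℕ-addMod i 1) (trans (cong (λ t → (t + 1) % suc n) i≡n)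
                 (trans (cong (_% suc n) (+-comm n 1)) (n%n≡0 (suc n))))

append : ∀ {A : Set} → ℕ → (ℕ → A) → (ℕ → A) → ℕ → A
append m p q t with t ≤? m
... | yes _ = p t
... | no _  = q (t ∸ suc m)

module _ {A : Set} (m : ℕ) (p q : ℕ → A) where

  append-≤ : ∀ {t} → t ≤ m → append m p q t ≡ p t
  append-≤ {t} t≤m with t ≤? m
  ... | yes _   = refl
  ... | no t≰m = ⊥-elim (t≰m t≤m)

  append-+ : ∀ d → append m p q (suc m + d) ≡ q d
  append-+ d with suc m + d ≤? m
  ... | yes m+d<m = ⊥-elim (<-irrefl refl (≤-trans (s≤s (m≤m+n m d)) m+d<m))
  ... | no _      = cong q (m+n∸m≡n (suc m) d)

≤⊎≡suc+ : ∀ m t → t ≤ m ⊎ ∃[ d ] t ≡ suc m + d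
≤⊎≡suc+ m t with t ≤? m
... | yes t≤m = inj₁ t≤m
... | no t≰m  = inj₂ (t ∸ suc m , sym (m+[n∸m]≡n (≰⇒> t≰m)))

IsPath-append : ∀ {N m n} {adj : Fin N → Fin N → Bool} {p q : ℕ → Fin N} →
  IsPath adj m p → IsPath adj n q → adj (p m) (q 0) ≡ true →
  (∀ {t u} → t ≤ m → u ≤ n → p t ≢ q u) → IsPath adj (suc (m + n)) (append m p q)
IsPath-append {N} {m} {n} {adj} {p} {q} P Q bridge disjoint = record { injective = inj ; adjacent = adj′ }
  where
  module P = IsPath P
  module Q = IsPath Q
  w = append m p q
  inj : ∀ {t u} → t ≤ suc (m + n) → u ≤ suc (m + n) → w t ≡ w u → t ≡ u
  inj {t} {u} t≤ u≤ e with ≤⊎≡suc+ m t | ≤⊎≡suc+ m u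
  ... | inj₁ t≤m | inj₁ u≤m = P.injective t≤m u≤m (trans (sym (append-≤ m p q t≤m)) (trans e (append-≤ m p q u≤m)))
  ... | inj₁ t≤m | inj₂ (d , refl) =
    ⊥-elim (disjoint t≤m (+-cancelˡ-≤ (suc m) d n u≤) (trans (sym (append-≤ m p q t≤m)) (trans e (append-+ m p q d))))
  ... | inj₂ (d , refl) | inj₁ u≤m =
    ⊥-elim (disjoint u≤m (+-cancelˡ-≤ (suc m) d n t≤) (trans (sym (append-≤ m p q u≤m)) (trans (sym e) (append-+ m p q d))))
  ... | inj₂ (d , refl) | inj₂ (d′ , refl) =
    cong (suc m +_) (Q.injective (+-cancelˡ-≤ (suc m) d n t≤) (+-cancelˡ-≤ (suc m) d′ n u≤)
                      (trans (sym (append-+ m p q d)) (trans e (append-+ m p q d′))))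
  adj′ : ∀ {t} → t < suc (m + n) → adj (w t) (w (suc t)) ≡ true
  adj′ {t} t< with ≤⊎≡suc+ m t
  ... | inj₂ (d , refl) = subst₂ (λ y z → adj y z ≡ true) (sym (append-+ m p q d))
          (sym (trans (cong w (sym (+-suc (suc m) d))) (append-+ m p q (suc d))))
          (Q.adjacent (+-cancelˡ-< (suc m) d n t<))
  ... | inj₁ t≤m with m≤n⇒m<n∨m≡n t≤m
  ...   | inj₁ t<m = subst₂ (λ y z → adj y z ≡ true) (sym (append-≤ m p q (<⇒≤ t<m))) (sym (append-≤ m p q t<m))
                       (P.adjacent t<m)
  ...   | inj₂ refl = subst₂ (λ y z → adj y z ≡ true) (sym (append-≤ m p q ≤-refl))
                       (sym (trans (cong w (sym (+-identityʳ (suc m)))) (append-+ m p q 0)))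
                       bridge

IsCycle⇒IsPath : ∀ {N L} {adj : Fin N → Fin N → Bool} {C : Fin L → Fin N} → IsCycle adj C →
  (x : Fin L) {n : ℕ} → n < L → IsPath adj n (λ t → C (addMod x t))
IsCycle⇒IsPath {adj = adj} {C} (C-inj , C-adj) x n<L = record
  { injective = λ t≤n u≤n e → addMod-injectiveʳ x (≤-<-trans t≤n n<L) (≤-<-trans u≤n n<L) (C-inj e)
  ; adjacent  = λ {t} _ → subst (λ y → adj (C (addMod x t)) (C y) ≡ true) (addMod-suc x t) (C-adj (addMod x t))
  }

path₃ : ∀ {N} → Fin N → Fin N → Fin N → ℕ → Fin N
path₃ u v w 0 = u
path₃ u v w 1 = v
path₃ u v w _ = w

IsPath-path₃ : ∀ {N} {adj : Fin N → Fin N → Bool} {u v w : Fin N} → u ≢ v → v ≢ w → u ≢ w →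
  adj u v ≡ true → adj v w ≡ true → IsPath adj 2 (path₃ u v w)
IsPath-path₃ {adj = adj} {u} {v} {w} u≢v v≢w u≢w uv vw = record { injective = inj ; adjacent = adj′ }
  where
  inj : ∀ {t t′} → t ≤ 2 → t′ ≤ 2 → path₃ u v w t ≡ path₃ u v w t′ → t ≡ t′
  inj {0} {0} _ _ _ = refl
  inj {1} {1} _ _ _ = refl
  inj {2} {2} _ _ _ = refl
  inj {0} {1} _ _ e = ⊥-elim (u≢v e)
  inj {0} {2} _ _ e = ⊥-elim (u≢w e)
  inj {1} {0} _ _ e = ⊥-elim (u≢v (sym e))
  inj {1} {2} _ _ e = ⊥-elim (v≢w e)
  inj {2} {0} _ _ e = ⊥-elim (u≢w (sym e))
  inj {2} {1} _ _ e = ⊥-elim (v≢w (sym e))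
  inj {suc (suc (suc _))} (s≤s (s≤s ())) _ _
  inj {_} {suc (suc (suc _))} _ (s≤s (s≤s ())) _
  adj′ : ∀ {t} → t < 2 → adj (path₃ u v w t) (path₃ u v w (suc t)) ≡ true
  adj′ {0} _ = uv
  adj′ {1} _ = vw
  adj′ {suc (suc _)} (s≤s (s≤s ()))

-- The red cycle C(x), C(x+1), …, C(x+s), b, c, a.
HasCycle-detour : ∀ {N L} {adj : Fin N → Fin N → Bool} {C : Fin L → Fin N} → IsCycle adj C →
  {a b c : Fin N} → (∀ i → C i ≢ a) → (∀ i → C i ≢ b) → (∀ i → C i ≢ c) → b ≢ c → c ≢ a → b ≢ a →
  adj b c ≡ true → adj c a ≡ true → (x : Fin L) (s : ℕ) → s < L →
  adj (C (addMod x s)) b ≡ true → adj a (C x) ≡ true → HasCycle adj (s + 4)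
HasCycle-detour {adj = adj} {C} isC {a} {b} {c} C≢a C≢b C≢c b≢c c≢a b≢a bc ca x s s<L Cb aC =
  subst (HasCycle adj) (sym s+4≡) (IsPath⇒HasCycle (IsPath-append arc (IsPath-path₃ b≢c c≢a b≢a bc ca) Cb off-arc) closing)
  where
  arc = IsCycle⇒IsPath isC x s<L
  off-arc : ∀ {t u} → t ≤ s → u ≤ 2 → C (addMod x t) ≢ path₃ b c a u
  off-arc {u = 0} _ _ = C≢b _
  off-arc {u = 1} _ _ = C≢c _
  off-arc {u = suc (suc _)} _ _ = C≢a _
  closing : adj (append s (λ t → C (addMod x t)) (path₃ b c a) (suc (s + 2))) (C (addMod x 0)) ≡ true
  closing = subst₂ (λ y z → adj y z ≡ true) (sym (append-+ s _ (path₃ b c a) 2)) (cong C (sym (addMod-zero x))) aC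
  s+4≡ : s + 4 ≡ suc (suc (s + 2))
  s+4≡ = trans (+-suc s 3) (cong suc (+-suc s 2))

blue-on-≤-blueDegH : ∀ {N L} (col : Colouring N) (v a : Fin N) (σ : Fin L → Fin N) → Injective _≡_ _≡_ σ →
  (∀ x → InH col v (σ x)) → (∀ x → σ x ≢ a) → countFin L (λ x → not (col a (σ x))) ≤ blueDegH col v a
blue-on-≤-blueDegH {N} {L} col v a σ σ-inj σ∈H σ≢a = countFin-≤-injection L N σ σ-inj _ _ blue⇒blueInH
  where
  blue⇒blueInH : ∀ x → not (col a (σ x)) ≡ true → (inHb col v (σ x) ∧ not (σ x ==F a) ∧ not (col a (σ x))) ≡ true
  blue⇒blueInH x blue rewrite σ∈H x | ==F-≢ (σ≢a x) = blue

==B-indicator : ∀ A B → ¬ (A ≡ true × B ≡ true) → indicator (A ==B B) + 1 ≤ indicator (not A) + indicator (not B)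
==B-indicator true  true  ¬both = ⊥-elim (¬both (refl , refl))
==B-indicator true  false _     = ≤-refl
==B-indicator false true  _     = ≤-refl
==B-indicator false false _     = ≤-refl

agreements+L≤blueDegH : ∀ {N L} (col : Colouring N) → SymColouring col →
  (C : Fin L → Fin N) → IsCycle (redAdj col) C → (v a b c : Fin N) →
  (∀ i → InH col v (C i) × C i ≢ a × C i ≢ b) → (∀ i → C i ≢ c) → a ≢ b → c ≢ a → c ≢ b →
  col a c ≡ true → col b c ≡ true → (s : ℕ) → s < L → ¬ HasCycle (redAdj col) (s + 4) →
  countFin L (λ x → col a (C x) ==B col b (C (addMod x s))) + L ≤ blueDegH col v a + blueDegH col v b
agreements+L≤blueDegH {L = L} col symm C isC v a b c onC C≢c a≢b c≢a c≢b ac bc s s<L noCycle = begin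
  countFin L (λ x → col a (C x) ==B col b (C′ x)) + L
    ≤⟨ countFin-+-pointwise L _ _ _ (λ x → ==B-indicator _ _ (not-both-red x)) ⟩
  countFin L (λ x → not (col a (C x))) + countFin L (λ x → not (col b (C′ x)))
    ≤⟨ +-mono-≤ (blue-on-≤-blueDegH col v a C C-inj (proj₁ ∘ onC) C≢a)
                (blue-on-≤-blueDegH col v b C′ C′-inj (proj₁ ∘ onC ∘ shift) (C≢b ∘ shift)) ⟩
  blueDegH col v a + blueDegH col v b ∎
  where
  open ≤-Reasoning
  shift : Fin L → Fin L
  shift x = addMod x s
  C′ : Fin L → Fin _
  C′ = C ∘ shift
  C-inj : Injective _≡_ _≡_ C
  C-inj = proj₁ isC
  C′-inj : Injective _≡_ _≡_ C′
  C′-inj = addMod-injectiveˡ s ∘ C-inj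
  C≢a : ∀ i → C i ≢ a
  C≢a = proj₁ ∘ proj₂ ∘ onC
  C≢b : ∀ i → C i ≢ b
  C≢b = proj₂ ∘ proj₂ ∘ onC
  not-both-red : ∀ x → ¬ (col a (C x) ≡ true × col b (C′ x) ≡ true)
  not-both-red x (aC , bC′) = noCycle (HasCycle-detour isC C≢a C≢b C≢c (c≢b ∘ sym) c≢a (a≢b ∘ sym)
    bc (trans (symm c a) ac) x s s<L (trans (symm (C′ x) b) bC′) aC)

lemma21 : (j k : ℕ) → k + 250 < j → 2 * j < 3 * k → 212299 ≤ j → 141534 ≤ k →
    (col : Colouring (4 * j + 1)) → SymColouring col →
    ¬ HasCycle (redAdj col) (2 * k + 1) →
    ¬ HasWheel (blueAdj col) (2 * j) →
    (v : Fin (4 * j + 1)) → MaxBlueDeg col v →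
    (a b : Fin (4 * j + 1)) → InH col v a → InH col v b → a ≢ b → col a b ≡ true →
    blueDegH col v a < j → blueDegH col v b < j →
    (C : Fin (2 * j ∸ 502) → Fin (4 * j + 1)) → IsCycle (redAdj col) C →
    (∀ i → InH col v (C i) × C i ≢ a × C i ≢ b) →
    (c : Fin (4 * j + 1)) → InH col v c → (∀ i → C i ≢ c) → c ≢ a → c ≢ b →
    col a c ≡ true → col b c ≡ true →
    (countFin (2 * j ∸ 502) (λ x → col a (C x) ==B col b (C (addMod x (2 * k ∸ 3)))) ≤ 500)
    × (countFin (2 * j ∸ 502) (λ x → col b (C x) ==B col a (C (addMod x (2 * k ∸ 3)))) ≤ 500)
lemma21 j k k+250<j _ _ 141534≤k col symm noC₂ₖ₊₁ _ v _ a b _ _ a≢b _ degA<j degB<j C isC onC c _ C≢c c≢a c≢b ac bc =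
    at-most-500 (agreements+L≤blueDegH col symm C isC v a b c onC C≢c a≢b c≢a c≢b ac bc s s<L noCycle)
  , at-most-500 (≤-trans
      (agreements+L≤blueDegH col symm C isC v b a c swapped C≢c (a≢b ∘ sym) c≢b c≢a bc ac s s<L noCycle)
      (≤-reflexive (+-comm (blueDegH col v b) (blueDegH col v a))))
  where
  L = 2 * j ∸ 502
  s = 2 * k ∸ 3
  swapped : ∀ i → InH col v (C i) × C i ≢ b × C i ≢ a
  swapped i = let (i∈H , i≢a , i≢b) = onC i in i∈H , i≢b , i≢a
  2k+502≤2j : 2 * k + 502 ≤ 2 * j
  2k+502≤2j = subst (_≤ 2 * j) (*-distribˡ-+ 2 k 251) (*-monoʳ-≤ 2 (subst (_≤ j) (sym (+-suc k 250)) k+250<j))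
  L+502≡2j : L + 502 ≡ 2 * j
  L+502≡2j = m∸n+n≡m (≤-trans (m≤n+m 502 (2 * k)) 2k+502≤2j)
  s+3≡2k : s + 3 ≡ 2 * k
  s+3≡2k = m∸n+n≡m (≤-trans (s≤s (s≤s (s≤s z≤n))) (≤-trans 141534≤k (m≤m+n k (k + 0))))
  s<L : s < L
  s<L = <-≤-trans (subst (s <_) s+3≡2k (m<m+n s z<s)) (m+n≤o⇒m≤o∸n (2 * k) 2k+502≤2j)
  noCycle : ¬ HasCycle (redAdj col) (s + 4)
  noCycle = noC₂ₖ₊₁ ∘ subst (HasCycle (redAdj col)) (trans (+-suc s 3) (trans (cong suc s+3≡2k) (+-comm 1 (2 * k))))
  at-most-500 : ∀ {agree} → agree + L ≤ blueDegH col v a + blueDegH col v b → agree ≤ 500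
  at-most-500 {agree} h = +-cancelʳ-≤ L agree 500 (s≤s⁻¹ (s≤s⁻¹ (begin
    2 + (agree + L)                        ≤⟨ +-monoʳ-≤ 2 h ⟩
    2 + (blueDegH col v a + blueDegH col v b) ≡⟨ cong suc (+-suc _ _) ⟨
    suc (blueDegH col v a) + suc (blueDegH col v b) ≤⟨ +-mono-≤ degA<j degB<j ⟩
    j + j                                  ≡⟨ cong (j +_) (+-identityʳ j) ⟨
    2 * j                                  ≡⟨ L+502≡2j ⟨
    L + 502                                ≡⟨ +-comm L 502 ⟩
    2 + (500 + L)                          ∎)))
    where open ≤-Reasoning
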